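{- Let $n$ be a positive integer. For $1 \le j \le n$, let $\mathbb{E}_j$ denote expectation when $A$ is chosen uniformly at random among all $j$-element subsets of $\{1,\dots,n\}$, and let $X = |A/A|$, where $A/A=\{a/a' : a,a'\in A\}$. Then for $s \in \{1,2\}$ and all integers $1 \le j < k \le n$, $$\mathbb{E}_j(X^s) \le \mathbb{E}_k(X^s) \le \mathbb{E}_j(X^s) + k^{2s} - j^{2s}.$$ -}

module Defs where

open import Data.Nat using (ℕ; zero; suc; _^_)
open import Data.Integer using (+_)
open import Data.List using (List; []; _∷_; map; _++_; concatMap; length; upTo; deduplicate)
open import Data.Rational using (ℚ; _/_; 0ℚ)
open import Data.Rational.Properties using (_≟_)
open import Data.Nat.ListAction using (sum)

combinations : ℕ → List ℕ → List (List ℕ)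
combinations zero    _        = [] ∷ []
combinations (suc k) []       = []
combinations (suc k) (x ∷ xs) = map (x ∷_) (combinations k xs) ++ combinations (suc k) xs

ground : ℕ → List ℕ
ground n = map suc (upTo n)

subsetsOfSize : ℕ → ℕ → List (List ℕ)
subsetsOfSize n j = combinations j (ground n)

-- the rational a / b (b is always ≥ 1 in our use; b = 0 is a junk case)
quot : ℕ → ℕ → ℚ
quot a zero    = 0ℚ
quot a (suc b) = (+ a) / suc b

quotientSet : List ℕ → List ℚ
quotientSet A = deduplicate _≟_ (concatMap (λ a → map (λ a' → quot a a') A) A)

X : List ℕ → ℕ
X A = length (quotientSet A)

average : List ℕ → ℚ
average xs with length xs
... | zero  = 0ℚ
... | suc m = (+ sum xs) / suc m

E : ℕ → ℕ → ℕ → ℚ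
E n j s = average (map (λ A → X A ^ s) (subsetsOfSize n j))

ℕtoℚ : ℕ → ℚ
ℕtoℚ m = (+ m) / 1

module Submission where

-- Write S_j(g) for the sum of g over the j-subsets of L = {1, …, n} and N_j for their number,
-- so E_j = S_j / N_j. Counting the pairs (A, x) with |A| = j and x ∉ A by A ∪ {x} and by A gives
-- (j + 1) S_{j+1}(g) = Σ_{|A| = j} Σ_{x ∉ A} g(A ∪ {x}) and (j + 1) N_{j+1} = (n − j) N_j. Hence
-- E_j ≤ E_{j+1} when g only grows under insertion, and E_{j+1} ≤ E_j + c(j + 1) − c(j) when
-- inserting an element into a j-set raises g by at most c(j + 1) − c(j); telescoping gives both
-- inequalities for all j ≤ k. For g = X^s and c(m) = m^{2s}: inserting x into A creates at most
-- e = 2|A| + 1 new quotients x/x, x/a, a/x, and since X(A) ≤ |A|² while t ↦ (t + e)^s − t^s is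
-- increasing, X^s grows by at most (|A|² + e)^s − (|A|²)^s = (|A| + 1)^{2s} − |A|^{2s}.

open import Defs
open import Data.Nat
  using (ℕ; zero; suc; pred; _*_; _^_; _∸_; _≤_; _<_; _≥_; _≤′_; ≤′-refl; ≤′-step; z≤n; s≤s)
import Data.Nat as ℕ
open import Data.Nat.Properties hiding (_≟_)
import Data.Integer as ℤ
import Data.Integer.Properties as ℤ
open import Data.Rational using (ℚ; _/_; _-_; -_; toℚᵘ) renaming (_≤_ to _≤ℚ_)
open import Data.Rational.Properties using (_≟_)
import Data.Rational.Properties as ℚ
import Data.Rational.Unnormalised as ℚᵘ
import Data.Rational.Unnormalised.Properties as ℚᵘ
open import Data.Rational.Solver using (module +-*-Solver)
open import Data.List using (List; []; _∷_; _++_; [_]; length; map; concatMap; upTo; deduplicate)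
open import Data.List.Properties
  using (length-++; length-++-sucʳ; length-map; length-upTo; map-++; map-∘; map-cong-local)
open import Data.List.Membership.Propositional using (_∈_; lose; find)
open import Data.List.Membership.Propositional.Properties
  using ( ∈-++⁺ˡ; ∈-++⁺ʳ; ∈-∃++; ∈-map⁺; ∈-map⁻; ∈-concatMap⁺; ∈-concatMap⁻
        ; ∈-deduplicate⁺; ∈-deduplicate⁻)
open import Data.List.Relation.Binary.Subset.Propositional using (_⊆_)
open import Data.List.Relation.Unary.Any using (here; there)
import Data.List.Relation.Unary.All as All
import Data.List.Relation.Unary.All.Properties as All
open import Data.List.Relation.Unary.AllPairs using (_∷_)
open import Data.List.Relation.Unary.Unique.Propositional using (Unique)
open import Data.List.Relation.Unary.Unique.DecPropositional.Properties using (deduplicate-!)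
open import Data.Nat.ListAction using (sum)
open import Data.Nat.ListAction.Properties using (sum-++)
open import Data.Product using (_×_; _,_; ∃; ∃₂)
open import Data.Sum using (_⊎_; inj₁; inj₂)
open import Data.Empty using (⊥-elim)
open import Function using (_∘_; id)
open import Relation.Binary.Core using (_Preserves₂_⟶_⟶_)
open import Relation.Binary.Definitions using (DecidableEquality; Reflexive; Transitive)
open import Relation.Binary.PropositionalEquality
  using (_≡_; refl; sym; trans; cong; cong₂; subst; subst₂; module ≡-Reasoning)
open import Data.Nat.Tactic.RingSolver using (solve-∀)
open +-*-Solver using (solve; _:+_; _:-_; _:=_)

∈-insert⁺ : ∀ {A : Set} {a x : A} pre {ys} → a ∈ pre ++ ys → a ∈ pre ++ x ∷ ys
∈-insert⁺ []        p         = there p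
∈-insert⁺ (_ ∷ pre) (here eq) = here eq
∈-insert⁺ (_ ∷ pre) (there p) = there (∈-insert⁺ pre p)

∈-insert⁻ : ∀ {A : Set} {a x : A} pre {ys} → a ∈ pre ++ x ∷ ys → a ≡ x ⊎ a ∈ pre ++ ys
∈-insert⁻ []        (here eq) = inj₁ eq
∈-insert⁻ []        (there p) = inj₂ p
∈-insert⁻ (_ ∷ pre) (here eq) = inj₂ (here eq)
∈-insert⁻ (_ ∷ pre) (there p) with ∈-insert⁻ pre p
... | inj₁ eq = inj₁ eq
... | inj₂ q  = inj₂ (there q)

Unique-⊆⇒length-≤ : ∀ {A : Set} {xs ys : List A} → Unique xs → xs ⊆ ys → length xs ≤ length ys
Unique-⊆⇒length-≤ {xs = []}     _          _   = z≤n
Unique-⊆⇒length-≤ {xs = x ∷ xs} (x∉xs ∷ u) sub with ∈-∃++ (sub (here refl))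
... | pre , post , refl = subst (suc (length xs) ≤_) (sym (length-++-sucʳ pre x post))
  (s≤s (Unique-⊆⇒length-≤ u (λ z∈xs → removeX (∈-insert⁻ pre (sub (there z∈xs))) z∈xs)))
  where
  removeX : ∀ {z} → z ≡ x ⊎ z ∈ pre ++ post → z ∈ xs → z ∈ pre ++ post
  removeX (inj₂ z∈)   _    = z∈
  removeX (inj₁ refl) x∈xs = ⊥-elim (All.lookup x∉xs x∈xs refl)

length-deduplicate-≤ : ∀ {A : Set} (_≟_ : DecidableEquality A) {xs ys : List A} →
  xs ⊆ ys → length (deduplicate _≟_ xs) ≤ length ys
length-deduplicate-≤ _≟_ {xs} xs⊆ys =
  Unique-⊆⇒length-≤ (deduplicate-! _≟_ xs) (xs⊆ys ∘ ∈-deduplicate⁻ _≟_ xs)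

-- ℕ addition stays local to these modules: the theorem is stated with the rational _+_.
module DoubleCounting where

  open import Data.Nat using (_+_)

  -- Insertion at an arbitrary position, so that both predicates pass from g to g ∘ (x ∷_).
  InsertionMonotone : (List ℕ → ℕ) → Set
  InsertionMonotone g = ∀ pre x A → g (pre ++ A) ≤ g (pre ++ x ∷ A)

  InsertionBoundedBy : (List ℕ → ℕ) → (ℕ → ℕ) → Set
  InsertionBoundedBy g c = ∀ pre x A →
    g (pre ++ x ∷ A) + c (length (pre ++ A)) ≤ g (pre ++ A) + c (suc (length (pre ++ A)))

  sumComb : ℕ → List ℕ → (List ℕ → ℕ) → ℕ
  sumComb k L g = sum (map g (combinations k L))

  numComb : ℕ → List ℕ → ℕ
  numComb k L = length (combinations k L)

  sumComb-cons : ∀ k x xs g → sumComb (suc k) (x ∷ xs) g ≡ sumComb k xs (g ∘ (x ∷_)) + sumComb (suc k) xs g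
  sumComb-cons k x xs g = begin
    sum (map g (map (x ∷_) C ++ D))            ≡⟨ cong sum (map-++ g (map (x ∷_) C) D) ⟩
    sum (map g (map (x ∷_) C) ++ map g D)      ≡⟨ sum-++ (map g (map (x ∷_) C)) (map g D) ⟩
    sum (map g (map (x ∷_) C)) + sum (map g D) ≡⟨ cong (λ ys → sum ys + sum (map g D)) (map-∘ C) ⟨
    sum (map (g ∘ (x ∷_)) C) + sum (map g D)   ∎
    where
    open ≡-Reasoning
    C = combinations k xs
    D = combinations (suc k) xs

  module _ {_∼_ : ℕ → ℕ → Set} (∼-refl : Reflexive _∼_)
           (+-mono-∼ : _+_ Preserves₂ _∼_ ⟶ _∼_ ⟶ _∼_) where

    private
      combine : ∀ {a₁ a₂ a₃ b₁ b₂ b₃ l r} → a₁ ∼ b₁ → a₂ ∼ b₂ → a₃ ∼ b₃ →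
        l ≡ a₁ + a₂ + a₃ → b₁ + b₂ + b₃ ≡ r → l ∼ r
      combine p q r refl refl = +-mono-∼ (+-mono-∼ p q) r

    sum-map-∼ : ∀ {A : Set} {f h : A → ℕ} xs → (∀ a → f a ∼ h a) → sum (map f xs) ∼ sum (map h xs)
    sum-map-∼ []       _   = ∼-refl
    sum-map-∼ (x ∷ xs) f∼h = +-mono-∼ (f∼h x) (sum-map-∼ xs f∼h)

    -- The term j * sumComb j L h on the left replaces (length L ∸ j) * sumComb j L h on the right.
    doubleCounting : ∀ L {g h} → (∀ pre x A → g (pre ++ x ∷ A) ∼ h (pre ++ A)) →
      ∀ j → (suc j * sumComb (suc j) L g + j * sumComb j L h) ∼ (length L * sumComb j L h)
    doubleCounting []       g∼h zero    = ∼-refl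
    doubleCounting []       g∼h (suc i) = subst (λ n → n ∼ 0) (sym (vanish i)) ∼-refl
      where
      vanish : ∀ i → suc (suc i) * 0 + suc i * 0 ≡ 0
      vanish = solve-∀
    doubleCounting (x ∷ xs) {g} {h} g∼h zero =
      combine (doubleCounting xs {g} {h} g∼h zero) (g∼h [] x []) (∼-refl {0})
        (trans (cong (λ n → 1 * n + 0) (sumComb-cons 0 x xs g)) (regroupˡ (g [ x ]) (sumComb 1 xs g)))
        (regroupʳ (length xs) (h []))
      where
      regroupˡ : ∀ a b → 1 * ((a + 0) + b) + 0 ≡ 1 * b + 0 + a + 0
      regroupˡ = solve-∀
      regroupʳ : ∀ m a → m * (a + 0) + a + 0 ≡ suc m * (a + 0)
      regroupʳ = solve-∀
    doubleCounting (x ∷ xs) {g} {h} g∼h (suc i) =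
      combine (doubleCounting xs (λ pre → g∼h (x ∷ pre)) i) (doubleCounting xs {g} {h} g∼h (suc i))
              (+-mono-∼ (∼-refl {P}) (sum-map-∼ (combinations (suc i) xs) (g∼h [] x)))
        (trans (cong₂ (λ a b → suc (suc i) * a + suc i * b) (sumComb-cons (suc i) x xs g) (sumComb-cons i x xs h))
               (regroupˡ i P Q R T))
        (trans (regroupʳ (length xs) P R) (cong (suc (length xs) *_) (sym (sumComb-cons i x xs h))))
      where
      P = sumComb i xs (h ∘ (x ∷_))
      Q = sumComb (suc i) xs (g ∘ (x ∷_))
      R = sumComb (suc i) xs h
      T = sumComb (suc (suc i)) xs g
      regroupˡ : ∀ i P Q R T →
        suc (suc i) * (Q + T) + suc i * (P + R) ≡ suc i * Q + i * P + (suc (suc i) * T + suc i * R) + (P + Q)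
      regroupˡ = solve-∀
      regroupʳ : ∀ m P R → m * P + m * R + (P + R) ≡ suc m * (P + R)
      regroupʳ = solve-∀

  sum-map-const : ∀ {A : Set} c (xs : List A) → sum (map (λ _ → c) xs) ≡ c * length xs
  sum-map-const c []       = sym (*-zeroʳ c)
  sum-map-const c (x ∷ xs) = trans (cong (c +_) (sum-map-const c xs)) (sym (*-suc c (length xs)))

  sum-map-+ : ∀ {A : Set} (f g : A → ℕ) xs → sum (map (λ a → f a + g a) xs) ≡ sum (map f xs) + sum (map g xs)
  sum-map-+ f g []       = refl
  sum-map-+ f g (x ∷ xs) = trans (cong (f x + g x +_) (sum-map-+ f g xs))
    (+-interchange (f x) (g x) (sum (map f xs)) (sum (map g xs)))
    where
    +-interchange : ∀ a b c d → a + b + (c + d) ≡ a + c + (b + d)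
    +-interchange = solve-∀

  combinations-length : ∀ k L → All.All (λ A → length A ≡ k) (combinations k L)
  combinations-length zero    L        = refl All.∷ All.[]
  combinations-length (suc k) []       = All.[]
  combinations-length (suc k) (x ∷ xs) = All.++⁺ (All.map⁺ (All.map (cong suc) (combinations-length k xs)))
                                                  (combinations-length (suc k) xs)

  sumComb-+-length : ∀ k L (g : List ℕ → ℕ) (f : ℕ → ℕ) →
    sumComb k L (λ A → g A + f (length A)) ≡ sumComb k L g + f k * numComb k L
  sumComb-+-length k L g f = begin
    sum (map (λ A → g A + f (length A)) C)
      ≡⟨ cong sum (map-cong-local (All.map (λ {A} → cong (λ n → g A + f n)) (combinations-length k L))) ⟩
    sum (map (λ A → g A + f k) C)           ≡⟨ sum-map-+ g (λ _ → f k) C ⟩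
    sumComb k L g + sum (map (λ _ → f k) C) ≡⟨ cong (sumComb k L g +_) (sum-map-const (f k) C) ⟩
    sumComb k L g + f k * numComb k L       ∎
    where
    open ≡-Reasoning
    C = combinations k L

  numComb-recurrence : ∀ L j → suc j * numComb (suc j) L + j * numComb j L ≡ length L * numComb j L
  numComb-recurrence L j = subst₂ (λ N N′ → suc j * N′ + j * N ≡ length L * N) (sumComb-1 j) (sumComb-1 (suc j))
    (doubleCounting {_≡_} refl (cong₂ _+_) L (λ _ _ _ → refl) j)
    where
    sumComb-1 : ∀ k → sumComb k L (λ _ → 1) ≡ numComb k L
    sumComb-1 k = trans (sum-map-const 1 (combinations k L)) (*-identityˡ _)

  numComb≡suc : ∀ {k} L → k ≤ length L → ∃ λ m → numComb k L ≡ suc m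
  numComb≡suc {zero}  L        _         = 0 , refl
  numComb≡suc {suc k} (x ∷ xs) (s≤s k≤m) with numComb≡suc xs k≤m
  ... | m , eq = m + numComb (suc k) xs , (begin
    length (map (x ∷_) C ++ combinations (suc k) xs) ≡⟨ length-++ (map (x ∷_) C) ⟩
    length (map (x ∷_) C) + numComb (suc k) xs       ≡⟨ cong (_+ numComb (suc k) xs) (trans (length-map (x ∷_) C) eq) ⟩
    suc m + numComb (suc k) xs                       ∎)
    where
    open ≡-Reasoning
    C = combinations k xs

  module _ (L : List ℕ) (j : ℕ) where

    private
      n = length L
      N = numComb j L
      N′ = numComb (suc j) L
      expandˡ : ∀ a T → N * (suc j * a + j * T) ≡ suc j * (a * N) + j * N * T
      expandˡ a T = distrib N j a T
        where
        distrib : ∀ N j a T → N * (suc j * a + j * T) ≡ suc j * (a * N) + j * N * T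
        distrib = solve-∀
      expandʳ : ∀ T → N * (n * T) ≡ suc j * (T * N′) + j * N * T
      expandʳ T = begin
        N * (n * T)                  ≡⟨ swap N n T ⟩
        (n * N) * T                  ≡⟨ cong (_* T) (numComb-recurrence L j) ⟨
        (suc j * N′ + j * N) * T     ≡⟨ distrib j N′ N T ⟩
        suc j * (T * N′) + j * N * T ∎
        where
        open ≡-Reasoning
        swap : ∀ N n T → N * (n * T) ≡ (n * N) * T
        swap = solve-∀
        distrib : ∀ j N′ N T → (suc j * N′ + j * N) * T ≡ suc j * (T * N′) + j * N * T
        distrib = solve-∀

    averaging-≤ : ∀ {a T} → suc j * a + j * T ≤ n * T → a * N ≤ T * N′
    averaging-≤ {a} {T} le = *-cancelˡ-≤ (suc j) (+-cancelʳ-≤ (j * N * T) _ _ (begin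
      suc j * (a * N) + j * N * T  ≡⟨ expandˡ a T ⟨
      N * (suc j * a + j * T)      ≤⟨ *-monoʳ-≤ N le ⟩
      N * (n * T)                  ≡⟨ expandʳ T ⟩
      suc j * (T * N′) + j * N * T ∎))
      where open ≤-Reasoning

    averaging-≥ : ∀ {a T} → n * T ≤ suc j * a + j * T → T * N′ ≤ a * N
    averaging-≥ {a} {T} le = *-cancelˡ-≤ (suc j) (+-cancelʳ-≤ (j * N * T) _ _ (begin
      suc j * (T * N′) + j * N * T ≡⟨ expandʳ T ⟨
      N * (n * T)                  ≤⟨ *-monoʳ-≤ N le ⟩
      N * (suc j * a + j * T)      ≡⟨ expandˡ a T ⟩
      suc j * (a * N) + j * N * T  ∎))
      where open ≤-Reasoning

  sumComb-mono : ∀ L {g} → InsertionMonotone g → ∀ j →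
    sumComb j L g * numComb (suc j) L ≤ sumComb (suc j) L g * numComb j L
  sumComb-mono L {g} mono j = averaging-≥ L j {sumComb (suc j) L g} {sumComb j L g}
    (doubleCounting {_≥_} ≤-refl +-mono-≤ L {g} {g} mono j)

  sumComb-bounded : ∀ L {g c} → InsertionBoundedBy g c → ∀ j →
    (sumComb (suc j) L g + c j * numComb (suc j) L) * numComb j L ≤
    (sumComb j L g + c (suc j) * numComb j L) * numComb (suc j) L
  sumComb-bounded L {g} {c} bounded j = subst₂ (λ a T → a * numComb j L ≤ T * numComb (suc j) L)
    (sumComb-+-length (suc j) L g (c ∘ pred)) (sumComb-+-length j L g (c ∘ suc))
    (averaging-≤ L j {sumComb (suc j) L g₁} {sumComb j L h₁}
      (doubleCounting {_≤_} ≤-refl +-mono-≤ L {g₁} {h₁} bounded′ j))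
    where
    g₁ h₁ : List ℕ → ℕ
    g₁ B = g B + c (pred (length B))
    h₁ A = g A + c (suc (length A))
    bounded′ : ∀ pre x A → g₁ (pre ++ x ∷ A) ≤ h₁ (pre ++ A)
    bounded′ pre x A rewrite length-++-sucʳ pre x A = bounded pre x A

open DoubleCounting

module QuotientSets where

  open import Data.Nat using (_+_)

  ratios : List ℕ → List ℚ
  ratios A = concatMap (λ a → map (quot a) A) A

  ∈-ratios⁺ : ∀ {a b A} → a ∈ A → b ∈ A → quot a b ∈ ratios A
  ∈-ratios⁺ {a} {A = A} a∈A b∈A = ∈-concatMap⁺ (λ a → map (quot a) A) (lose a∈A (∈-map⁺ (quot a) b∈A))

  ∈-ratios⁻ : ∀ {q A} → q ∈ ratios A → ∃₂ λ a b → a ∈ A × b ∈ A × q ≡ quot a b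
  ∈-ratios⁻ {A = A} q∈ with find (∈-concatMap⁻ (λ a → map (quot a) A) q∈)
  ... | a , a∈A , q∈aA with ∈-map⁻ (quot a) q∈aA
  ...   | b , b∈A , q≡a/b = a , b , a∈A , b∈A , q≡a/b

  length-ratios : ∀ A → length (ratios A) ≡ length A * length A
  length-ratios A = go A
    where
    go : ∀ as → length (concatMap (λ a → map (quot a) A) as) ≡ length as * length A
    go []       = refl
    go (a ∷ as) = trans (length-++ (map (quot a) A)) (cong₂ _+_ (length-map (quot a) A) (go as))

  X≤length² : ∀ A → X A ≤ length A * length A
  X≤length² A = subst (X A ≤_) (length-ratios A) (length-deduplicate-≤ _≟_ {ratios A} id)

  X-insert-mono : ∀ pre x A → X (pre ++ A) ≤ X (pre ++ x ∷ A)
  X-insert-mono pre x A = length-deduplicate-≤ _≟_ (∈-deduplicate⁺ _≟_ ∘ insert)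
    where
    insert : ratios (pre ++ A) ⊆ ratios (pre ++ x ∷ A)
    insert q∈ with ∈-ratios⁻ q∈
    ... | a , b , a∈ , b∈ , refl = ∈-ratios⁺ (∈-insert⁺ pre a∈) (∈-insert⁺ pre b∈)

  X-insert-growth : ∀ pre x A → X (pre ++ x ∷ A) ≤ X (pre ++ A) + suc (length (pre ++ A) + length (pre ++ A))
  X-insert-growth pre x A = subst (X (pre ++ x ∷ A) ≤_) length-old++new (length-deduplicate-≤ _≟_ split)
    where
    A′ = pre ++ A
    new : List ℚ
    new = quot x x ∷ map (quot x) A′ ++ map (λ a → quot a x) A′
    length-old++new : length (quotientSet A′ ++ new) ≡ X A′ + suc (length A′ + length A′)
    length-old++new = trans (length-++ (quotientSet A′))
      (cong (λ n → X A′ + suc n)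
        (trans (length-++ (map (quot x) A′)) (cong₂ _+_ (length-map _ A′) (length-map _ A′))))
    split : ratios (pre ++ x ∷ A) ⊆ quotientSet A′ ++ new
    split q∈ with ∈-ratios⁻ q∈
    ... | a , b , a∈ , b∈ , refl with ∈-insert⁻ {x = x} pre a∈ | ∈-insert⁻ {x = x} pre b∈
    ... | inj₁ refl | inj₁ refl = ∈-++⁺ʳ _ (here refl)
    ... | inj₁ refl | inj₂ b∈A′ = ∈-++⁺ʳ _ (there (∈-++⁺ˡ (∈-map⁺ (quot x) b∈A′)))
    ... | inj₂ a∈A′ | inj₁ refl = ∈-++⁺ʳ _ (there (∈-++⁺ʳ _ (∈-map⁺ (λ a → quot a x) a∈A′)))
    ... | inj₂ a∈A′ | inj₂ b∈A′ = ∈-++⁺ˡ (∈-deduplicate⁺ _≟_ (∈-ratios⁺ a∈A′ b∈A′))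

  [t+e]^s+u^s≤t^s+[u+e]^s : ∀ s e {t u} → t ≤ u → (t + e) ^ s + u ^ s ≤ t ^ s + (u + e) ^ s
  [t+e]^s+u^s≤t^s+[u+e]^s s e {t} t≤u = subst (λ u → (t + e) ^ s + u ^ s ≤ t ^ s + (u + e) ^ s)
    (m+[n∸m]≡n t≤u) (shifted s (_ ∸ t))
    where
    shifted : ∀ s δ → (t + e) ^ s + (t + δ) ^ s ≤ t ^ s + (t + δ + e) ^ s
    shifted zero    δ = ≤-refl
    shifted (suc s) δ = begin
      (t + e) * A + (t + δ) * b     ≡⟨ expand t e δ A b ⟩
      t * (A + b) + (e * A + δ * b)
        ≤⟨ +-mono-≤ (*-monoʳ-≤ t (shifted s δ)) (+-mono-≤ (*-monoʳ-≤ e A≤B) (*-monoʳ-≤ δ b≤B)) ⟩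
      t * (a + B) + (e * B + δ * B) ≡⟨ collect t e δ a B ⟩
      t * a + (t + δ + e) * B       ∎
      where
      open ≤-Reasoning
      a = t ^ s
      A = (t + e) ^ s
      b = (t + δ) ^ s
      B = (t + δ + e) ^ s
      A≤B : A ≤ B
      A≤B = ^-monoˡ-≤ s (+-monoˡ-≤ e (m≤m+n t δ))
      b≤B : b ≤ B
      b≤B = ^-monoˡ-≤ s (m≤m+n (t + δ) e)
      expand : ∀ t e δ A b → (t + e) * A + (t + δ) * b ≡ t * (A + b) + (e * A + δ * b)
      expand = solve-∀
      collect : ∀ t e δ a B → t * (a + B) + (e * B + δ * B) ≡ t * a + (t + δ + e) * B
      collect = solve-∀

  X^s-insertionMonotone : ∀ s → InsertionMonotone (λ A → X A ^ s)
  X^s-insertionMonotone s pre x A = ^-monoˡ-≤ s (X-insert-mono pre x A)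

  X^s-insertionBounded : ∀ s → InsertionBoundedBy (λ A → X A ^ s) (λ m → m ^ (2 * s))
  X^s-insertionBounded s pre x A = begin
    X (pre ++ x ∷ A) ^ s + m ^ (2 * s)  ≡⟨ cong (X (pre ++ x ∷ A) ^ s +_) (^[2*s]≡[²]^s m) ⟩
    X (pre ++ x ∷ A) ^ s + (m * m) ^ s  ≤⟨ +-monoˡ-≤ _ (^-monoˡ-≤ s (X-insert-growth pre x A)) ⟩
    (X A′ + e) ^ s + (m * m) ^ s        ≤⟨ [t+e]^s+u^s≤t^s+[u+e]^s s e (X≤length² A′) ⟩
    X A′ ^ s + (m * m + e) ^ s          ≡⟨ cong (λ n → X A′ ^ s + n ^ s) (square-suc m) ⟩
    X A′ ^ s + (suc m * suc m) ^ s      ≡⟨ cong (X A′ ^ s +_) (^[2*s]≡[²]^s (suc m)) ⟨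
    X A′ ^ s + suc m ^ (2 * s)          ∎
    where
    open ≤-Reasoning
    A′ = pre ++ A
    m = length A′
    e = suc (m + m)
    ^[2*s]≡[²]^s : ∀ n → n ^ (2 * s) ≡ (n * n) ^ s
    ^[2*s]≡[²]^s n = trans (sym (^-*-assoc n 2 s)) (cong (λ k → (n * k) ^ s) (*-identityʳ n))
    square-suc : ∀ m → m * m + suc (m + m) ≡ suc m * suc m
    square-suc = solve-∀

open QuotientSets using (X^s-insertionMonotone; X^s-insertionBounded)

open import Data.Integer using (+_)
open import Data.Rational using (_+_)

toℚᵘ-/ : ∀ n m → toℚᵘ ((+ n) / suc m) ℚᵘ.≃ ℚᵘ.mkℚᵘ (+ n) m
toℚᵘ-/ n m = ℚ.toℚᵘ-fromℚᵘ (ℚᵘ.mkℚᵘ (+ n) m)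

≤-cross⇒/≤/ : ∀ a b {m n} → a * suc n ≤ b * suc m → (+ a) / suc m ≤ℚ (+ b) / suc n
≤-cross⇒/≤/ a b {m} {n} le = ℚ.toℚᵘ-cancel-≤
  (ℚᵘ.≤-respˡ-≃ (ℚᵘ.≃-sym (toℚᵘ-/ a m)) (ℚᵘ.≤-respʳ-≃ (ℚᵘ.≃-sym (toℚᵘ-/ b n))
    (ℚᵘ.*≤* (subst₂ ℤ._≤_ (ℤ.pos-* a (suc n)) (ℤ.pos-* b (suc m)) (ℤ.+≤+ le)))))

/-+-ℕtoℚ : ∀ a c m → (+ (a ℕ.+ c * suc m)) / suc m ≡ (+ a) / suc m + ℕtoℚ c
/-+-ℕtoℚ a c m = ℚ.toℚᵘ-injective (begin
  toℚᵘ ((+ (a ℕ.+ c * suc m)) / suc m)     ≈⟨ toℚᵘ-/ (a ℕ.+ c * suc m) m ⟩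
  ℚᵘ.mkℚᵘ (+ (a ℕ.+ c * suc m)) m           ≈⟨ ℚᵘ.*≡* cross ⟩
  ℚᵘ.mkℚᵘ (+ a) m ℚᵘ.+ ℚᵘ.mkℚᵘ (+ c) 0      ≈⟨ ℚᵘ.+-cong (toℚᵘ-/ a m) (toℚᵘ-/ c 0) ⟨
  toℚᵘ ((+ a) / suc m) ℚᵘ.+ toℚᵘ (ℕtoℚ c)   ≈⟨ ℚ.toℚᵘ-homo-+ ((+ a) / suc m) (ℕtoℚ c) ⟨
  toℚᵘ ((+ a) / suc m + ℕtoℚ c)            ∎)
  where
  open ℚᵘ.≃-Reasoning
  cross : + (a ℕ.+ c * suc m) ℤ.* (+ suc (m * 1)) ≡ (+ a ℤ.* + 1 ℤ.+ + c ℤ.* + suc m) ℤ.* + suc m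
  cross = cong₂ ℤ._*_
    (trans (ℤ.pos-+ a (c * suc m)) (cong₂ ℤ._+_ (sym (ℤ.*-identityʳ (+ a))) (ℤ.pos-* c (suc m))))
    (cong (λ k → + suc k) (*-identityʳ m))

p+q≤r+t⇒p≤r+[t-q] : ∀ {p q r t} → p + q ≤ℚ r + t → p ≤ℚ r + (t - q)
p+q≤r+t⇒p≤r+[t-q] {p} {q} {r} {t} le = subst₂ _≤ℚ_
  (solve 2 (λ p q → (p :+ q) :- q := p) refl p q)
  (solve 3 (λ r t q → (r :+ t) :- q := r :+ (t :- q)) refl r t q)
  (ℚ.+-monoˡ-≤ (- q) le)

module _ {R : ℕ → ℕ → Set} (R-refl : Reflexive R) (R-trans : Transitive R) where

  stepwise : ∀ {n} → (∀ {i} → suc i ≤ n → R i (suc i)) → ∀ {j k} → j ≤′ k → k ≤ n → R j k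
  stepwise step ≤′-refl            _   = R-refl
  stepwise step (≤′-step j≤′k) k≤n = R-trans (stepwise step j≤′k (<⇒≤ k≤n)) (step k≤n)

average≡ : ∀ xs {m} → length xs ≡ suc m → average xs ≡ (+ sum xs) / suc m
average≡ xs eq rewrite eq = refl

mean : ℕ → List ℕ → (List ℕ → ℕ) → ℚ
mean k L g = average (map g (combinations k L))

mean≡ : ∀ k L g {m} → numComb k L ≡ suc m → mean k L g ≡ (+ sumComb k L g) / suc m
mean≡ k L g eq = average≡ (map g (combinations k L)) (trans (length-map g (combinations k L)) eq)

mean-mono-step : ∀ L {g} → InsertionMonotone g → ∀ {j} → suc j ≤ length L → mean j L g ≤ℚ mean (suc j) L g
mean-mono-step L {g} mono {j} j<n with numComb≡suc L (<⇒≤ j<n) | numComb≡suc L j<n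
... | m , N≡ | m′ , N′≡ =
  subst₂ _≤ℚ_ (sym (mean≡ j L g N≡)) (sym (mean≡ (suc j) L g N′≡)) (≤-cross⇒/≤/ S S′ cross)
  where
  S = sumComb j L g
  S′ = sumComb (suc j) L g
  cross : S * suc m′ ≤ S′ * suc m
  cross = subst₂ (λ N N′ → S * N′ ≤ S′ * N) N≡ N′≡ (sumComb-mono L mono j)

mean-bounded-step : ∀ L {g c} → InsertionBoundedBy g c → ∀ {j} → suc j ≤ length L →
  mean (suc j) L g ≤ℚ mean j L g + (ℕtoℚ (c (suc j)) - ℕtoℚ (c j))
mean-bounded-step L {g} {c} bounded {j} j<n with numComb≡suc L (<⇒≤ j<n) | numComb≡suc L j<n
... | m , N≡ | m′ , N′≡ = p+q≤r+t⇒p≤r+[t-q] {q = ℕtoℚ (c j)} {mean j L g} {ℕtoℚ (c (suc j))}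
  (subst₂ _≤ℚ_ lhs rhs (≤-cross⇒/≤/ (S′ ℕ.+ c j * suc m′) (S ℕ.+ c (suc j) * suc m) cross))
  where
  S = sumComb j L g
  S′ = sumComb (suc j) L g
  cross : (S′ ℕ.+ c j * suc m′) * suc m ≤ (S ℕ.+ c (suc j) * suc m) * suc m′
  cross = subst₂ (λ N N′ → (S′ ℕ.+ c j * N′) * N ≤ (S ℕ.+ c (suc j) * N) * N′) N≡ N′≡
    (sumComb-bounded L {g} {c} bounded j)
  lhs : (+ (S′ ℕ.+ c j * suc m′)) / suc m′ ≡ mean (suc j) L g + ℕtoℚ (c j)
  lhs = trans (/-+-ℕtoℚ S′ (c j) m′) (cong (_+ ℕtoℚ (c j)) (sym (mean≡ (suc j) L g N′≡)))
  rhs : (+ (S ℕ.+ c (suc j) * suc m)) / suc m ≡ mean j L g + ℕtoℚ (c (suc j))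
  rhs = trans (/-+-ℕtoℚ S (c (suc j)) m) (cong (_+ ℕtoℚ (c (suc j))) (sym (mean≡ j L g N≡)))

mean-mono : ∀ L {g} → InsertionMonotone g → ∀ {j k} → j ≤ k → k ≤ length L → mean j L g ≤ℚ mean k L g
mean-mono L mono j≤k = stepwise ℚ.≤-refl ℚ.≤-trans (mean-mono-step L mono) (≤⇒≤′ j≤k)

mean-bounded : ∀ L {g c} → InsertionBoundedBy g c → ∀ {j k} → j ≤ k → k ≤ length L →
  mean k L g ≤ℚ mean j L g + (ℕtoℚ (c k) - ℕtoℚ (c j))
mean-bounded L {g} {c} bounded j≤k =
  stepwise (λ {j} → R-refl {j}) (λ {i j k} → R-trans {i} {j} {k})
    (mean-bounded-step L {g} {c} bounded) (≤⇒≤′ j≤k)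
  where
  C : ℕ → ℚ
  C = ℕtoℚ ∘ c
  R : ℕ → ℕ → Set
  R j k = mean k L g ≤ℚ mean j L g + (C k - C j)
  R-refl : Reflexive R
  R-refl {j} = ℚ.≤-reflexive (solve 2 (λ e c → e := e :+ (c :- c)) refl (mean j L g) (C j))
  R-trans : Transitive R
  R-trans {i} {j} {k} Rij Rjk = ℚ.≤-trans Rjk (ℚ.≤-trans (ℚ.+-monoˡ-≤ (C k - C j) Rij)
    (ℚ.≤-reflexive (solve 4 (λ e a b c → (e :+ (b :- a)) :+ (c :- b) := e :+ (c :- a)) refl
      (mean i L g) (C i) (C j) (C k))))

length-ground : ∀ n → length (ground n) ≡ n
length-ground n = trans (length-map suc (upTo n)) (length-upTo n)

-- Holds for every s.
lemma3p1 : (n : ℕ) → 1 ≤ n → (s : ℕ) → (s ≡ 1 ⊎ s ≡ 2) →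
    (j k : ℕ) → 1 ≤ j → j < k → k ≤ n →
      (E n j s ≤ℚ E n k s)
        × (E n k s ≤ℚ (E n j s + (ℕtoℚ (k ^ (2 * s)) - ℕtoℚ (j ^ (2 * s)))))
lemma3p1 n _ s _ j k _ j<k k≤n =
  mean-mono L (X^s-insertionMonotone s) (<⇒≤ j<k) k≤|L| ,
  mean-bounded L {c = λ m → m ^ (2 * s)} (X^s-insertionBounded s) (<⇒≤ j<k) k≤|L|
  where
  L = ground n
  k≤|L| : k ≤ length L
  k≤|L| = subst (k ≤_) (sym (length-ground n)) k≤n
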